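{- For $m,n\geq 0$, the lattice $\mathbf{Bub}(m,n)$ has exactly $mn+m+n$ join-irreducible elements and exactly $mn+m+n$ meet-irreducible elements.
   Context: Disjoint alphabets $X=\{x_1,\dots,x_m\}$, $Y=\{y_1,\dots,y_n\}$. A word is simple if it has no repeated letter. $\mathsf{Shuf}(m,n)$ is the set of simple words over $X\cup Y$ in which the letters of $X$ appear in increasing order of index and those of $Y$ in increasing order of index. For $\mathbf{u}=u_1\cdots u_k$, $\mathbf{u}_{\hat\imath}$ is $\mathbf{u}$ with $u_i$ deleted. Indels: $\mathbf{u}\to\mathbf{u}_{\hat\imath}$ if $u_i\in X$, and $\mathbf{u}_{\hat\imath}\to\mathbf{u}$ if $u_i\in Y$. Transpositions: $\mathbf{u}\Rightarrow\mathbf{u}'$ where $u_i\in X$, $u_{i+1}\in Y$ and $\mathbf{u}'$ is $\mathbf{u}$ with $u_i,u_{i+1}$ swapped. The bubble order $\leq_{\mathsf{bub}}$ is the reflexive transitive closure of indels and transpositions; $\mathbf{Bub}(m,n)=(\mathsf{Shuf}(m,n),\leq_{\mathsf{bub}})$, a finite lattice. In a finite lattice, join-irreducibles are the elements covering exactly one element, and meet-irreducibles are those covered by exactly one element. -}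

module Defs where

open import Data.Nat using (ℕ)
open import Data.Fin using (Fin; _<_)
open import Data.List using (List; []; _∷_; _++_; length; lookup; removeAt; mapMaybe)
open import Data.List.Relation.Unary.Unique.Propositional using (Unique)
open import Data.List.Relation.Unary.Linked using (Linked)
open import Data.List.Membership.Propositional using (_∈_)
open import Data.Maybe using (Maybe; just; nothing)
open import Data.Product using (Σ; ∃; _×_; _,_)
open import Data.Sum using (_⊎_)
open import Function.Bundles using (_⇔_)
open import Relation.Binary.PropositionalEquality using (_≡_)
open import Relation.Binary.Construct.Closure.ReflexiveTransitive using (Star)
open import Relation.Nullary using (¬_)

-- Letters over the disjoint alphabets X = {x_1..x_m} and Y = {y_1..y_n}
-- (indices are 0-based, via Fin).
data Letter (m n : ℕ) : Set where
  x : Fin m → Letter m n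
  y : Fin n → Letter m n

Word : ℕ → ℕ → Set
Word m n = List (Letter m n)

data IsX {m n : ℕ} : Letter m n → Set where
  isX : (i : Fin m) → IsX (x i)

data IsY {m n : ℕ} : Letter m n → Set where
  isY : (j : Fin n) → IsY (y j)

xIndex : ∀ {m n} → Letter m n → Maybe (Fin m)
xIndex (x i) = just i
xIndex (y _) = nothing

yIndex : ∀ {m n} → Letter m n → Maybe (Fin n)
yIndex (x _) = nothing
yIndex (y j) = just j

Simple : ∀ {m n} → Word m n → Set
Simple u = Unique u

Shuf : (m n : ℕ) → Word m n → Set
Shuf m n u = Simple u
           × Linked _<_ (mapMaybe xIndex u)
           × Linked _<_ (mapMaybe yIndex u)

data Step (m n : ℕ) : Word m n → Word m n → Set where
  del : ∀ {u} → Shuf m n u → (i : Fin (length u)) → IsX (lookup u i)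
      → Shuf m n (removeAt u i) → Step m n u (removeAt u i)
  ins : ∀ {u} → Shuf m n u → (i : Fin (length u)) → IsY (lookup u i)
      → Shuf m n (removeAt u i) → Step m n (removeAt u i) u
  swap : ∀ p s (i : Fin m) (j : Fin n)
       → Shuf m n (p ++ x i ∷ y j ∷ s) → Shuf m n (p ++ y j ∷ x i ∷ s)
       → Step m n (p ++ x i ∷ y j ∷ s) (p ++ y j ∷ x i ∷ s)

_≤bub_ : ∀ {m n} → Word m n → Word m n → Set
_≤bub_ {m} {n} = Star (Step m n)

_⋖_ : ∀ {m n} → Word m n → Word m n → Set
_⋖_ {m} {n} v u = Shuf m n v × Shuf m n u × v ≤bub u × ¬ (v ≡ u)
  × (∀ w → Shuf m n w → v ≤bub w → w ≤bub u → (w ≡ v ⊎ w ≡ u))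

JoinIrreducible : (m n : ℕ) → Word m n → Set
JoinIrreducible m n u = Shuf m n u × Σ (Word m n) λ v → v ⋖ u × (∀ w → w ⋖ u → w ≡ v)

MeetIrreducible : (m n : ℕ) → Word m n → Set
MeetIrreducible m n u = Shuf m n u × Σ (Word m n) λ v → u ⋖ v × (∀ w → u ⋖ w → w ≡ v)

HasExactly : ∀ {m n} → ℕ → (Word m n → Set) → Set
HasExactly {m} {n} k P = Σ (List (Word m n)) λ L →
  Unique L × length L ≡ k × (∀ u → (u ∈ L) ⇔ P u)

-- Going up in the bubble order, x-letters can only disappear, y-letters can only appear,
-- and an inversion y_l x_k persists as long as x_k does; so the order is antisymmetric and
-- a shuffle is determined by its letters and its inversions.  From this one reads off the
-- lower covers of a shuffle u: for each missing x_i, reinsert x_i just before the next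
-- x-letter of larger index (or at the end); for each y_j in u, move y_j back past the
-- x-letter right after it, or delete y_j if no x-letter follows it immediately.  These
-- covers are pairwise distinct, so u is join-irreducible exactly when it lacks a single
-- x-letter and has no y-letter (m words), or has all x-letters and a single y-letter
-- (n(m+1) words, one per position of that letter).  Exchanging the roles of X and Y is an
-- order-reversing isomorphism Bub(m,n) → Bub(n,m), which turns meet-irreducibles into
-- join-irreducibles.

module Submission where

open import Defs
open import Data.Nat using (ℕ; _+_; _*_)
open import Data.Product using (_×_)

open import Data.Nat as ℕ using (zero; suc; z≤n; s≤s)
import Data.Nat.Properties as ℕ
open import Data.Fin as Fin using (Fin; zero; suc; toℕ)
import Data.Fin.Properties as Fin
open import Data.List using (List; []; _∷_; _++_; length; map; lookup; removeAt; mapMaybe; tabulate; allFin; cartesianProduct)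
import Data.List.Properties as List
open import Data.List.Membership.Propositional using (_∈_; _∉_)
open import Data.List.Membership.Propositional.Properties
open import Data.List.Relation.Unary.Any using (here; there)
import Data.List.Relation.Unary.All as All
open import Data.List.Relation.Unary.AllPairs using (AllPairs; _∷_; [])
import Data.List.Relation.Unary.AllPairs.Properties as AllPairs
open import Data.List.Relation.Unary.Unique.Propositional using (Unique)
import Data.List.Relation.Unary.Unique.Propositional.Properties as Unique
open import Data.List.Relation.Unary.Linked.Properties using (Linked⇒AllPairs; AllPairs⇒Linked)
open import Data.Product using (Σ; ∃; _,_; proj₁; proj₂)
open import Data.Product.Properties using (,-injective)
open import Data.Maybe using (Maybe; just; nothing)
open import Data.Maybe.Properties using (just-injective)
open import Data.Sum using (_⊎_; inj₁; inj₂)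
open import Data.Empty using (⊥-elim)
open import Relation.Nullary using (¬_; Dec; yes; no; _×-dec_)
open import Relation.Nullary.Decidable using (decidable-stable)
open import Relation.Binary.Definitions using (DecidableEquality)
open import Relation.Binary.PropositionalEquality
open import Relation.Binary.Construct.Closure.ReflexiveTransitive using (ε; _◅_; _◅◅_)
open import Function using (id)
open import Function.Bundles using (mk⇔; Equivalence)
open import Data.Nat.Tactic.RingSolver using (solve-∀)

data Before {A : Set} (a b : A) : List A → Set where
  now   : ∀ {t} → b ∈ t → Before a b (a ∷ t)
  later : ∀ {c t} → Before a b t → Before a b (c ∷ t)

module _ {A : Set} where

  NoRepeats : List A → Set
  NoRepeats u = ∀ a → ¬ Before a a u

  before⇒∈ˡ : ∀ {a b : A} {u} → Before a b u → a ∈ u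
  before⇒∈ˡ (now _)   = here refl
  before⇒∈ˡ (later p) = there (before⇒∈ˡ p)

  before⇒∈ʳ : ∀ {a b : A} {u} → Before a b u → b ∈ u
  before⇒∈ʳ (now b∈t) = there b∈t
  before⇒∈ʳ (later p) = there (before⇒∈ʳ p)

  NoRepeats-tail : ∀ {c : A} {t} → NoRepeats (c ∷ t) → NoRepeats t
  NoRepeats-tail U a p = U a (later p)

  NoRepeats-head : ∀ {c : A} {t} → NoRepeats (c ∷ t) → c ∉ t
  NoRepeats-head U c∈t = U _ (now c∈t)

  AllPairs⇒before : ∀ {R : A → A → Set} {u} → AllPairs R u → ∀ {a b} → Before a b u → R a b
  AllPairs⇒before (Ra ∷ _) (now b∈t) = All.lookup Ra b∈t
  AllPairs⇒before (_ ∷ P)  (later q) = AllPairs⇒before P q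

  before⇒AllPairs : ∀ {R : A → A → Set} {u} → (∀ {a b} → Before a b u → R a b) → AllPairs R u
  before⇒AllPairs {u = []}    _ = []
  before⇒AllPairs {u = c ∷ t} f = All.tabulate (λ b∈t → f (now b∈t)) ∷ before⇒AllPairs (λ q → f (later q))

  Unique⇒NoRepeats : ∀ {u : List A} → Unique u → NoRepeats u
  Unique⇒NoRepeats U a q = AllPairs⇒before U q refl

  NoRepeats⇒Unique : ∀ {u : List A} → NoRepeats u → Unique u
  NoRepeats⇒Unique {u} U = before⇒AllPairs (λ {a} q a≡b → U a (subst (λ b → Before a b u) (sym a≡b) q))

  before-++⁺ˡ : ∀ {a b : A} {p} s → Before a b p → Before a b (p ++ s)
  before-++⁺ˡ s (now b∈p) = now (∈-++⁺ˡ b∈p)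
  before-++⁺ˡ s (later q) = later (before-++⁺ˡ s q)

  before-++⁺ʳ : ∀ {a b : A} p {s} → Before a b s → Before a b (p ++ s)
  before-++⁺ʳ []      q = q
  before-++⁺ʳ (c ∷ p) q = later (before-++⁺ʳ p q)

  before-++⁺ : ∀ {a b : A} {p s} → a ∈ p → b ∈ s → Before a b (p ++ s)
  before-++⁺ {p = c ∷ p} (here refl) b∈s = now (∈-++⁺ʳ p b∈s)
  before-++⁺ {p = c ∷ p} (there a∈p) b∈s = later (before-++⁺ a∈p b∈s)

  before-++⁻ : ∀ {a b : A} p {s} → Before a b (p ++ s)
             → Before a b p ⊎ (a ∈ p × b ∈ s) ⊎ Before a b s
  before-++⁻ []      q = inj₂ (inj₂ q)
  before-++⁻ (c ∷ p) (now b∈ps) with ∈-++⁻ p b∈ps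
  ... | inj₁ b∈p = inj₁ (now b∈p)
  ... | inj₂ b∈s = inj₂ (inj₁ (here refl , b∈s))
  before-++⁻ (c ∷ p) (later q) with before-++⁻ p q
  ... | inj₁ r                 = inj₁ (later r)
  ... | inj₂ (inj₁ (a∈p , b∈s)) = inj₂ (inj₁ (there a∈p , b∈s))
  ... | inj₂ (inj₂ r)          = inj₂ (inj₂ r)

  ∈-insert⁺ : ∀ {a : A} p {c s} → a ∈ p ++ s → a ∈ p ++ c ∷ s
  ∈-insert⁺ p a∈ps with ∈-++⁻ p a∈ps
  ... | inj₁ a∈p = ∈-++⁺ˡ a∈p
  ... | inj₂ a∈s = ∈-++⁺ʳ p (there a∈s)

  ∈-remove⁺ : ∀ {a : A} p {c s} → a ∈ p ++ c ∷ s → a ≢ c → a ∈ p ++ s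
  ∈-remove⁺ p a∈pcs a≢c with ∈-++⁻ p a∈pcs
  ... | inj₁ a∈p         = ∈-++⁺ˡ a∈p
  ... | inj₂ (here a≡c)  = ⊥-elim (a≢c a≡c)
  ... | inj₂ (there a∈s) = ∈-++⁺ʳ p a∈s

  ∈-swap⁺ : ∀ {a : A} p {c d s} → a ∈ p ++ c ∷ d ∷ s → a ∈ p ++ d ∷ c ∷ s
  ∈-swap⁺ p a∈ with ∈-++⁻ p a∈
  ... | inj₁ a∈p                 = ∈-++⁺ˡ a∈p
  ... | inj₂ (here a≡c)          = ∈-++⁺ʳ p (there (here a≡c))
  ... | inj₂ (there (here a≡d))  = ∈-++⁺ʳ p (here a≡d)
  ... | inj₂ (there (there a∈s)) = ∈-++⁺ʳ p (there (there a∈s))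

  before-insert⁺ : ∀ {a b : A} p {c s} → Before a b (p ++ s) → Before a b (p ++ c ∷ s)
  before-insert⁺ p q with before-++⁻ p q
  ... | inj₁ r                 = before-++⁺ˡ _ r
  ... | inj₂ (inj₁ (a∈p , b∈s)) = before-++⁺ a∈p (there b∈s)
  ... | inj₂ (inj₂ r)          = before-++⁺ʳ p (later r)

  before-remove⁺ : ∀ {a b : A} p {c s} → Before a b (p ++ c ∷ s) → a ≢ c → b ≢ c
                → Before a b (p ++ s)
  before-remove⁺ p q a≢c b≢c with before-++⁻ p q
  ... | inj₁ r                         = before-++⁺ˡ _ r
  ... | inj₂ (inj₁ (_   , here b≡c))   = ⊥-elim (b≢c b≡c)
  ... | inj₂ (inj₁ (a∈p , there b∈s))  = before-++⁺ a∈p b∈s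
  ... | inj₂ (inj₂ (now _))            = ⊥-elim (a≢c refl)
  ... | inj₂ (inj₂ (later r))          = before-++⁺ʳ p r

  before-swap⁺ : ∀ {a b : A} p {c d s} → Before a b (p ++ c ∷ d ∷ s) → ¬ (a ≡ c × b ≡ d)
              → Before a b (p ++ d ∷ c ∷ s)
  before-swap⁺ p q ¬cd with before-++⁻ p q
  ... | inj₁ r                            = before-++⁺ˡ _ r
  ... | inj₂ (inj₁ (a∈p , b∈))            = before-++⁺ a∈p (∈-swap⁺ [] b∈)
  ... | inj₂ (inj₂ (now (here b≡d)))      = ⊥-elim (¬cd (refl , b≡d))
  ... | inj₂ (inj₂ (now (there b∈s)))     = before-++⁺ʳ p (later (now b∈s))
  ... | inj₂ (inj₂ (later (now b∈s)))     = before-++⁺ʳ p (now (there b∈s))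
  ... | inj₂ (inj₂ (later (later r)))     = before-++⁺ʳ p (later (later r))

  before-total : ∀ {a b : A} {u} → a ∈ u → b ∈ u → a ≢ b → Before a b u ⊎ Before b a u
  before-total (here refl) (here refl) a≢b = ⊥-elim (a≢b refl)
  before-total (here refl) (there b∈) _    = inj₁ (now b∈)
  before-total (there a∈) (here refl) _    = inj₂ (now a∈)
  before-total (there a∈) (there b∈) a≢b with before-total a∈ b∈ a≢b
  ... | inj₁ r = inj₁ (later r)
  ... | inj₂ r = inj₂ (later r)

  before-asym : ∀ {a b : A} {u} → NoRepeats u → Before a b u → ¬ Before b a u
  before-asym U (now _)   (now a∈)  = U _ (now a∈)
  before-asym U (now _)   (later r) = U _ (now (before⇒∈ʳ r))
  before-asym U (later q) (now _)   = U _ (now (before⇒∈ʳ q))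
  before-asym U (later q) (later r) = before-asym (NoRepeats-tail U) q r

  before-trans : ∀ {a b c : A} {u} → NoRepeats u → Before a b u → Before b c u → Before a c u
  before-trans U (now b∈)  (now _)   = ⊥-elim (U _ (now b∈))
  before-trans U (now _)   (later r) = now (before⇒∈ʳ r)
  before-trans U (later q) (now _)   = ⊥-elim (U _ (now (before⇒∈ʳ q)))
  before-trans U (later q) (later r) = later (before-trans (NoRepeats-tail U) q r)

  before-successor⇒before : ∀ {a b d : A} p {s} → NoRepeats (p ++ b ∷ d ∷ s)
                          → Before a d (p ++ b ∷ d ∷ s) → a ≢ b → Before a b (p ++ b ∷ d ∷ s)
  before-successor⇒before {d = d} p U q a≢b with before-++⁻ p q
  ... | inj₁ r                       = ⊥-elim (U d (before-++⁺ (before⇒∈ʳ r) (there (here refl))))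
  ... | inj₂ (inj₁ (a∈p , _))        = before-++⁺ a∈p (here refl)
  ... | inj₂ (inj₂ (now _))          = ⊥-elim (a≢b refl)
  ... | inj₂ (inj₂ (later (now d∈))) = ⊥-elim (U d (before-++⁺ʳ p (later (now d∈))))
  ... | inj₂ (inj₂ (later (later r))) =
    ⊥-elim (U d (before-++⁺ʳ p (later (now (before⇒∈ʳ r)))))

  before⇒∈-suffix : ∀ {a b : A} p {s} → NoRepeats (p ++ a ∷ s) → Before a b (p ++ a ∷ s) → b ∈ s
  before⇒∈-suffix {a} p U q with before-++⁻ p q
  ... | inj₁ r                = ⊥-elim (U a (before-++⁺ (before⇒∈ˡ r) (here refl)))
  ... | inj₂ (inj₁ (a∈p , _)) = ⊥-elim (U a (before-++⁺ a∈p (here refl)))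
  ... | inj₂ (inj₂ (now b∈s)) = b∈s
  ... | inj₂ (inj₂ (later r)) = ⊥-elim (U a (before-++⁺ʳ p (now (before⇒∈ˡ r))))

  before⇒∈-prefix : ∀ {a c : A} p {s} → NoRepeats (p ++ c ∷ s) → Before a c (p ++ c ∷ s) → a ∈ p
  before⇒∈-prefix {c = c} p U q with before-++⁻ p q
  ... | inj₁ r                = ⊥-elim (U c (before-++⁺ (before⇒∈ʳ r) (here refl)))
  ... | inj₂ (inj₁ (a∈p , _)) = a∈p
  ... | inj₂ (inj₂ (now c∈s)) = ⊥-elim (U c (before-++⁺ʳ p (now c∈s)))
  ... | inj₂ (inj₂ (later r)) = ⊥-elim (U c (before-++⁺ʳ p (now (before⇒∈ʳ r))))

  NoRepeats⇒∉-removed : ∀ {c : A} p {s} → NoRepeats (p ++ c ∷ s) → c ∉ p ++ s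
  NoRepeats⇒∉-removed p U c∈ps with ∈-++⁻ p c∈ps
  ... | inj₁ c∈p = U _ (before-++⁺ c∈p (here refl))
  ... | inj₂ c∈s = U _ (before-++⁺ʳ p (now c∈s))

  NoRepeats-remove : ∀ p {c : A} {s} → NoRepeats (p ++ c ∷ s) → NoRepeats (p ++ s)
  NoRepeats-remove p U a q = U a (before-insert⁺ p q)

  NoRepeats-insert : DecidableEquality A → ∀ p {c : A} {s}
                   → NoRepeats (p ++ s) → c ∉ p ++ s → NoRepeats (p ++ c ∷ s)
  NoRepeats-insert _≟_ p {c} U c∉ a q with a ≟ c
  ... | no a≢c = U a (before-remove⁺ p q a≢c a≢c)
  ... | yes refl with before-++⁻ p q
  ...   | inj₁ r                = c∉ (∈-++⁺ˡ (before⇒∈ˡ r))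
  ...   | inj₂ (inj₁ (c∈p , _)) = c∉ (∈-++⁺ˡ c∈p)
  ...   | inj₂ (inj₂ (now c∈s)) = c∉ (∈-++⁺ʳ p c∈s)
  ...   | inj₂ (inj₂ (later r)) = c∉ (∈-++⁺ʳ p (before⇒∈ˡ r))

  ≡-from-before : DecidableEquality A → ∀ {u u′ : List A} → NoRepeats u → NoRepeats u′
                → (∀ {c} → c ∈ u → c ∈ u′) → (∀ {c} → c ∈ u′ → c ∈ u)
                → (∀ {a b} → Before a b u → Before a b u′) → u ≡ u′
  ≡-from-before _≟_ {[]}    {[]}     _ _ _ _ _ = refl
  ≡-from-before _≟_ {[]}    {c ∷ _}  _ _ _ u′⊆u _ with u′⊆u (here refl)
  ... | ()
  ≡-from-before _≟_ {c ∷ _} {[]}     _ _ u⊆u′ _ _ with u⊆u′ (here refl)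
  ... | ()
  ≡-from-before _≟_ {a ∷ t} {a′ ∷ t′} U U′ u⊆u′ u′⊆u before⁺ with a ≟ a′
  ... | no a≢a′ = ⊥-elim (a′-not-after-a (before⁺ (now a′∈t)))
    where
    a′∈t : a′ ∈ t
    a′∈t with u′⊆u (here refl)
    ... | here a′≡a = ⊥-elim (a≢a′ (sym a′≡a))
    ... | there a′∈ = a′∈
    a′-not-after-a : ¬ Before a a′ (a′ ∷ t′)
    a′-not-after-a (now _)   = a≢a′ refl
    a′-not-after-a (later r) = U′ a′ (now (before⇒∈ʳ r))
  ... | yes refl = cong (a ∷_)
    (≡-from-before _≟_ (NoRepeats-tail U) (NoRepeats-tail U′) t⊆t′ t′⊆t tail-before⁺)
    where
    t⊆t′ : ∀ {c} → c ∈ t → c ∈ t′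
    t⊆t′ c∈t with u⊆u′ (there c∈t)
    ... | here refl = ⊥-elim (NoRepeats-head U c∈t)
    ... | there c∈t′ = c∈t′
    t′⊆t : ∀ {c} → c ∈ t′ → c ∈ t
    t′⊆t c∈t′ with u′⊆u (there c∈t′)
    ... | here refl = ⊥-elim (NoRepeats-head U′ c∈t′)
    ... | there c∈t = c∈t
    tail-before⁺ : ∀ {p q} → Before p q t → Before p q t′
    tail-before⁺ r with before⁺ (later r)
    ... | now _    = ⊥-elim (NoRepeats-head U (before⇒∈ˡ r))
    ... | later r′ = r′

  middle-index : ∀ p {c : A} {s} → Fin (length (p ++ c ∷ s))
  middle-index []      = zero
  middle-index (_ ∷ p) = suc (middle-index p)

  removeAt-middle-index : ∀ p {c : A} {s} → removeAt (p ++ c ∷ s) (middle-index p) ≡ p ++ s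
  removeAt-middle-index []      = refl
  removeAt-middle-index (d ∷ p) = cong (d ∷_) (removeAt-middle-index p)

  lookup-middle-index : ∀ p {c : A} {s} → lookup (p ++ c ∷ s) (middle-index p) ≡ c
  lookup-middle-index []      = refl
  lookup-middle-index (d ∷ p) = lookup-middle-index p

  split-at-index : ∀ (u : List A) i → Σ (List A) λ p → Σ (List A) λ s →
                   u ≡ p ++ lookup u i ∷ s × removeAt u i ≡ p ++ s
  split-at-index (c ∷ u) zero = [] , u , refl , refl
  split-at-index (c ∷ u) (suc i) with split-at-index u i
  ... | p , s , u≡ , removed≡ = c ∷ p , s , cong (c ∷_) u≡ , cong (c ∷_) removed≡

before-map⁺ : ∀ {A B : Set} (f : A → B) {a b : A} {u} → Before a b u → Before (f a) (f b) (map f u)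
before-map⁺ f (now b∈)  = now (∈-map⁺ f b∈)
before-map⁺ f (later q) = later (before-map⁺ f q)

length-allFin : ∀ k → length (allFin k) ≡ k
length-allFin k = List.length-tabulate id

length-cartesianProduct : ∀ {A B : Set} (as : List A) (bs : List B) →
                          length (cartesianProduct as bs) ≡ length as * length bs
length-cartesianProduct []       bs = refl
length-cartesianProduct (a ∷ as) bs =
  trans (List.length-++ (map (a ,_) bs)) (cong₂ _+_ (List.length-map (a ,_) bs) (length-cartesianProduct as bs))

module _ {A : Set} where

  insert-at : ℕ → A → List A → List A
  insert-at zero    c xs       = c ∷ xs
  insert-at (suc p) c []       = c ∷ []
  insert-at (suc p) c (d ∷ xs) = d ∷ insert-at p c xs

  insert-at-split : ∀ p (c : A) xs → Σ (List A) λ a → Σ (List A) λ b →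
                    insert-at p c xs ≡ a ++ c ∷ b × a ++ b ≡ xs
  insert-at-split zero    c xs       = [] , xs , refl , refl
  insert-at-split (suc p) c []       = [] , [] , refl , refl
  insert-at-split (suc p) c (d ∷ xs) with insert-at-split p c xs
  ... | a , b , ins≡ , ab≡ = d ∷ a , b , cong (d ∷_) ins≡ , cong (d ∷_) ab≡

  insert-at-length : ∀ (a b : List A) {c xs} → a ++ b ≡ xs → a ++ c ∷ b ≡ insert-at (length a) c xs
  insert-at-length []      b refl = refl
  insert-at-length (d ∷ a) b refl = cong (d ∷_) (insert-at-length a b refl)

  insert-at-end : ∀ (c : A) xs → insert-at (length xs) c xs ≡ xs ++ c ∷ []
  insert-at-end c []       = refl
  insert-at-end c (d ∷ xs) = cong (d ∷_) (insert-at-end c xs)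

  insert-at-injective : ∀ {c : A} xs {p p′} → c ∉ xs → p ℕ.≤ length xs → p′ ℕ.≤ length xs
                      → insert-at p c xs ≡ insert-at p′ c xs → p ≡ p′
  insert-at-injective xs {zero} {zero} _ _ _ _ = refl
  insert-at-injective (d ∷ xs) {zero} {suc _} c∉ _ _ e = ⊥-elim (c∉ (here (List.∷-injectiveˡ e)))
  insert-at-injective (d ∷ xs) {suc _} {zero} c∉ _ _ e = ⊥-elim (c∉ (here (sym (List.∷-injectiveˡ e))))
  insert-at-injective (d ∷ xs) {suc p} {suc p′} c∉ (s≤s p≤) (s≤s p′≤) e =
    cong suc (insert-at-injective xs (λ c∈ → c∉ (there c∈)) p≤ p′≤ (List.∷-injectiveʳ e))

  insert-at-suc : ∀ p (c : A) xs → suc p ℕ.≤ length xs → Σ (List A) λ pre → Σ A λ d → Σ (List A) λ rest →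
                  insert-at (suc p) c xs ≡ pre ++ d ∷ c ∷ rest × insert-at p c xs ≡ pre ++ c ∷ d ∷ rest
  insert-at-suc zero    c (d ∷ xs) _         = [] , d , xs , refl , refl
  insert-at-suc (suc p) c (d ∷ xs) (s≤s p<) with insert-at-suc p c xs p<
  ... | pre , d′ , rest , e₁ , e₂ = d ∷ pre , d′ , rest , cong (d ∷_) e₁ , cong (d ∷_) e₂

module _ {A B : Set} (f : A → Maybe B) where

  ∈-mapMaybe⁺ : ∀ {a b} {u : List A} → a ∈ u → f a ≡ just b → b ∈ mapMaybe f u
  ∈-mapMaybe⁺ {u = c ∷ u} (here refl) fa≡b with f c
  ... | just _ = here (just-injective (sym fa≡b))
  ∈-mapMaybe⁺ {u = c ∷ u} (there a∈u) fa≡b with f c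
  ... | just _  = there (∈-mapMaybe⁺ a∈u fa≡b)
  ... | nothing = ∈-mapMaybe⁺ a∈u fa≡b

  ∈-mapMaybe⁻ : ∀ {b} (u : List A) → b ∈ mapMaybe f u → ∃ λ a → a ∈ u × f a ≡ just b
  ∈-mapMaybe⁻ (c ∷ u) b∈ with f c in fc≡
  ∈-mapMaybe⁻ (c ∷ u) (here refl) | just _ = c , here refl , fc≡
  ∈-mapMaybe⁻ (c ∷ u) (there b∈) | just _ with ∈-mapMaybe⁻ u b∈
  ... | a , a∈u , fa≡b = a , there a∈u , fa≡b
  ∈-mapMaybe⁻ (c ∷ u) b∈ | nothing with ∈-mapMaybe⁻ u b∈
  ... | a , a∈u , fa≡b = a , there a∈u , fa≡b

  before-mapMaybe⁺ : ∀ {a b a′ b′} {u : List A} → Before a b u → f a ≡ just a′ → f b ≡ just b′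
                   → Before a′ b′ (mapMaybe f u)
  before-mapMaybe⁺ (now b∈t) fa≡ fb≡ rewrite fa≡ = now (∈-mapMaybe⁺ b∈t fb≡)
  before-mapMaybe⁺ {u = c ∷ _} (later q) fa≡ fb≡ with f c
  ... | just _  = later (before-mapMaybe⁺ q fa≡ fb≡)
  ... | nothing = before-mapMaybe⁺ q fa≡ fb≡

  before-mapMaybe⁻ : ∀ {a′ b′} (u : List A) → Before a′ b′ (mapMaybe f u)
                   → ∃ λ a → ∃ λ b → Before a b u × f a ≡ just a′ × f b ≡ just b′
  before-mapMaybe⁻ (c ∷ u) q with f c in fc≡
  before-mapMaybe⁻ (c ∷ u) (now b′∈) | just _ with ∈-mapMaybe⁻ u b′∈
  ... | b , b∈u , fb≡ = c , b , now b∈u , fc≡ , fb≡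
  before-mapMaybe⁻ (c ∷ u) (later q) | just _ with before-mapMaybe⁻ u q
  ... | a , b , r , fa≡ , fb≡ = a , b , later r , fa≡ , fb≡
  before-mapMaybe⁻ (c ∷ u) q | nothing with before-mapMaybe⁻ u q
  ... | a , b , r , fa≡ , fb≡ = a , b , later r , fa≡ , fb≡

-- Shuffles and the bubble order

module _ {m n : ℕ} where

  x-injective : ∀ {i k : Fin m} → x {m} {n} i ≡ x k → i ≡ k
  x-injective refl = refl

  y-injective : ∀ {j l : Fin n} → y {m} {n} j ≡ y l → j ≡ l
  y-injective refl = refl

  _≟ₗ_ : DecidableEquality (Letter m n)
  x i ≟ₗ x k with i Fin.≟ k
  ... | yes refl = yes refl
  ... | no i≢k   = no (λ e → i≢k (x-injective e))
  x i ≟ₗ y j = no (λ ())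
  y j ≟ₗ x i = no (λ ())
  y j ≟ₗ y l with j Fin.≟ l
  ... | yes refl = yes refl
  ... | no j≢l   = no (λ e → j≢l (y-injective e))

  XIncreasing : Word m n → Set
  XIncreasing u = ∀ {i k} → Before (x i) (x k) u → i Fin.< k

  YIncreasing : Word m n → Set
  YIncreasing u = ∀ {j l} → Before (y j) (y l) u → j Fin.< l

  IsShuffle : Word m n → Set
  IsShuffle u = NoRepeats u × XIncreasing u × YIncreasing u

  xIndex≡just⇒ : ∀ {c : Letter m n} {i} → xIndex c ≡ just i → c ≡ x i
  xIndex≡just⇒ {x _} refl = refl

  yIndex≡just⇒ : ∀ {c : Letter m n} {j} → yIndex c ≡ just j → c ≡ y j
  yIndex≡just⇒ {y _} refl = refl

  Shuf⇒IsShuffle : ∀ {u} → Shuf m n u → IsShuffle u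
  Shuf⇒IsShuffle (U , X , Y) =
      Unique⇒NoRepeats U
    , (λ q → AllPairs⇒before (Linked⇒AllPairs Fin.<-trans X) (before-mapMaybe⁺ xIndex q refl refl))
    , (λ q → AllPairs⇒before (Linked⇒AllPairs Fin.<-trans Y) (before-mapMaybe⁺ yIndex q refl refl))

  IsShuffle⇒Shuf : ∀ {u} → IsShuffle u → Shuf m n u
  IsShuffle⇒Shuf {u} (U , X , Y) =
    NoRepeats⇒Unique U , AllPairs⇒Linked (before⇒AllPairs x-order) , AllPairs⇒Linked (before⇒AllPairs y-order)
    where
    x-order : ∀ {i k} → Before i k (mapMaybe xIndex u) → i Fin.< k
    x-order q with before-mapMaybe⁻ xIndex u q
    ... | _ , _ , r , xa≡ , xb≡ rewrite xIndex≡just⇒ xa≡ | xIndex≡just⇒ xb≡ = X r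
    y-order : ∀ {j l} → Before j l (mapMaybe yIndex u) → j Fin.< l
    y-order q with before-mapMaybe⁻ yIndex u q
    ... | _ , _ , r , ya≡ , yb≡ rewrite yIndex≡just⇒ ya≡ | yIndex≡just⇒ yb≡ = Y r

  IsShuffle-remove : ∀ p {c : Letter m n} {s} → IsShuffle (p ++ c ∷ s) → IsShuffle (p ++ s)
  IsShuffle-remove p (U , X , Y) = NoRepeats-remove p U , (λ q → X (before-insert⁺ p q)) , (λ q → Y (before-insert⁺ p q))

  data Move : Word m n → Word m n → Set where
    delete-x : ∀ p s i   → Move (p ++ x i ∷ s) (p ++ s)
    insert-y : ∀ p s j   → Move (p ++ s) (p ++ y j ∷ s)
    swap-xy  : ∀ p s i j → Move (p ++ x i ∷ y j ∷ s) (p ++ y j ∷ x i ∷ s)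

  IsX⇒≡x : ∀ {c : Letter m n} → IsX c → ∃ λ i → c ≡ x i
  IsX⇒≡x (isX i) = i , refl

  IsY⇒≡y : ∀ {c : Letter m n} → IsY c → ∃ λ j → c ≡ y j
  IsY⇒≡y (isY j) = j , refl

  step⇒move : ∀ {a b} → Step m n a b → IsShuffle a × IsShuffle b × Move a b
  step⇒move (del {u} S i isX-i S′) with split-at-index u i | IsX⇒≡x isX-i
  ... | p , s , u≡ , removed≡ | k , c≡xk =
    Shuf⇒IsShuffle S , Shuf⇒IsShuffle S′ ,
    subst₂ Move (sym (trans u≡ (cong (λ c → p ++ c ∷ s) c≡xk))) (sym removed≡) (delete-x p s k)
  step⇒move (ins {u} S i isY-i S′) with split-at-index u i | IsY⇒≡y isY-i
  ... | p , s , u≡ , removed≡ | l , c≡yl =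
    Shuf⇒IsShuffle S′ , Shuf⇒IsShuffle S ,
    subst₂ Move (sym removed≡) (sym (trans u≡ (cong (λ c → p ++ c ∷ s) c≡yl))) (insert-y p s l)
  step⇒move (swap p s i j S S′) = Shuf⇒IsShuffle S , Shuf⇒IsShuffle S′ , swap-xy p s i j

  delete-step : ∀ p {i s} → IsShuffle (p ++ x i ∷ s) → IsShuffle (p ++ s)
              → Step m n (p ++ x i ∷ s) (p ++ s)
  delete-step p {i} S S′ = subst (Step m n _) (removeAt-middle-index p)
    (del (IsShuffle⇒Shuf S) (middle-index p) (subst IsX (sym (lookup-middle-index p)) (isX i))
         (subst (Shuf m n) (sym (removeAt-middle-index p)) (IsShuffle⇒Shuf S′)))

  insert-step : ∀ p {j s} → IsShuffle (p ++ y j ∷ s) → IsShuffle (p ++ s)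
              → Step m n (p ++ s) (p ++ y j ∷ s)
  insert-step p {j} {s} S S′ = subst (λ w → Step m n w (p ++ y j ∷ s)) (removeAt-middle-index p)
    (ins (IsShuffle⇒Shuf S) (middle-index p) (subst IsY (sym (lookup-middle-index p)) (isY j))
         (subst (Shuf m n) (sym (removeAt-middle-index p)) (IsShuffle⇒Shuf S′)))

  swap-step : ∀ p {i j s} → IsShuffle (p ++ x i ∷ y j ∷ s) → IsShuffle (p ++ y j ∷ x i ∷ s)
            → Step m n (p ++ x i ∷ y j ∷ s) (p ++ y j ∷ x i ∷ s)
  swap-step p {i} {j} {s} S S′ = swap p s i j (IsShuffle⇒Shuf S) (IsShuffle⇒Shuf S′)

  move-x-antitone : ∀ {a b} → Move a b → ∀ {k} → x k ∈ b → x k ∈ a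
  move-x-antitone (delete-x p s i)  xk∈ = ∈-insert⁺ p xk∈
  move-x-antitone (insert-y p s j)  xk∈ = ∈-remove⁺ p xk∈ (λ ())
  move-x-antitone (swap-xy p s i j) xk∈ = ∈-swap⁺ p xk∈

  move-y-monotone : ∀ {a b} → Move a b → ∀ {l} → y l ∈ a → y l ∈ b
  move-y-monotone (delete-x p s i)  yl∈ = ∈-remove⁺ p yl∈ (λ ())
  move-y-monotone (insert-y p s j)  yl∈ = ∈-insert⁺ p yl∈
  move-y-monotone (swap-xy p s i j) yl∈ = ∈-swap⁺ p yl∈

  move-inversion-monotone : ∀ {a b} → Move a b → NoRepeats a
                          → ∀ {l k} → Before (y l) (x k) a → x k ∈ b → Before (y l) (x k) b
  move-inversion-monotone (delete-x p s i) U q xk∈ =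
    before-remove⁺ p q (λ ()) (λ e → NoRepeats⇒∉-removed p U (subst (_∈ p ++ s) e xk∈))
  move-inversion-monotone (insert-y p s j)  U q _ = before-insert⁺ p q
  move-inversion-monotone (swap-xy p s i j) U q _ = before-swap⁺ p q (λ { (() , _) })

  x-antitone : ∀ {a b : Word m n} → a ≤bub b → ∀ {k} → x k ∈ b → x k ∈ a
  x-antitone ε xk∈ = xk∈
  x-antitone (st ◅ r) xk∈ with step⇒move st
  ... | _ , _ , mv = move-x-antitone mv (x-antitone r xk∈)

  y-monotone : ∀ {a b : Word m n} → a ≤bub b → ∀ {l} → y l ∈ a → y l ∈ b
  y-monotone ε yl∈ = yl∈
  y-monotone (st ◅ r) yl∈ with step⇒move st
  ... | _ , _ , mv = y-monotone r (move-y-monotone mv yl∈)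

  inversion-monotone : ∀ {a b : Word m n} → a ≤bub b
                     → ∀ {l k} → Before (y l) (x k) a → x k ∈ b → Before (y l) (x k) b
  inversion-monotone ε q _ = q
  inversion-monotone (st ◅ r) q xk∈ with step⇒move st
  ... | (U , _) , _ , mv = inversion-monotone r (move-inversion-monotone mv U q (x-antitone r xk∈)) xk∈

  step-acyclic : ∀ {a b} → Step m n a b → ¬ b ≤bub a
  step-acyclic st r with step⇒move st
  ... | (U , _) , _ , delete-x p s i = NoRepeats⇒∉-removed p U (x-antitone r (∈-insert p))
  ... | _ , (U , _) , insert-y p s j = NoRepeats⇒∉-removed p U (y-monotone r (∈-insert p))
  ... | (U , _) , _ , swap-xy p s i j =
    before-asym U (before-++⁺ʳ p (now (here refl))) (inversion-monotone r (before-++⁺ʳ p (now (here refl))) (∈-insert p))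

  ≤bub-antisym : ∀ {a b : Word m n} → a ≤bub b → b ≤bub a → a ≡ b
  ≤bub-antisym ε        _  = refl
  ≤bub-antisym (st ◅ r) r′ = ⊥-elim (step-acyclic st (r ◅◅ r′))

  step⇒≢ : ∀ {a b} → Step m n a b → a ≢ b
  step⇒≢ st refl = step-acyclic st ε

  _⊆ₓ_ _⊆ᵧ_ _⊆ᵢ_ : Word m n → Word m n → Set
  u ⊆ₓ u′ = ∀ {k} → x k ∈ u → x k ∈ u′
  u ⊆ᵧ u′ = ∀ {l} → y l ∈ u → y l ∈ u′
  u ⊆ᵢ u′ = ∀ {l k} → Before (y l) (x k) u → Before (y l) (x k) u′

  letters-⊆ : ∀ {u u′} → u ⊆ₓ u′ → u ⊆ᵧ u′ → ∀ {c} → c ∈ u → c ∈ u′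
  letters-⊆ ⊆x ⊆y {x _} = ⊆x
  letters-⊆ ⊆x ⊆y {y _} = ⊆y

  <⇒before-x : ∀ {w i k} → IsShuffle w → x i ∈ w → x k ∈ w → i Fin.< k → Before (x i) (x k) w
  <⇒before-x (_ , X , _) xi∈ xk∈ i<k with before-total xi∈ xk∈ (λ e → Fin.<-irrefl (x-injective e) i<k)
  ... | inj₁ r = r
  ... | inj₂ r = ⊥-elim (Fin.<-asym i<k (X r))

  <⇒before-y : ∀ {w j l} → IsShuffle w → y j ∈ w → y l ∈ w → j Fin.< l → Before (y j) (y l) w
  <⇒before-y (_ , _ , Y) yj∈ yl∈ j<l with before-total yj∈ yl∈ (λ e → Fin.<-irrefl (y-injective e) j<l)
  ... | inj₁ r = r
  ... | inj₂ r = ⊥-elim (Fin.<-asym j<l (Y r))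

  -- The x–x and y–y orders are forced by the index order, and an x–y order is the absence of
  -- the opposite inversion.
  before-⊆ : ∀ {u u′} → IsShuffle u → IsShuffle u′ → u ⊆ₓ u′ → u ⊆ᵧ u′ → u ⊆ᵢ u′ → u′ ⊆ᵢ u
           → ∀ {a b} → Before a b u → Before a b u′
  before-⊆ Su Su′ ⊆x ⊆y _ _ {x i} {x k} q =
    <⇒before-x Su′ (⊆x (before⇒∈ˡ q)) (⊆x (before⇒∈ʳ q)) (proj₁ (proj₂ Su) q)
  before-⊆ Su Su′ ⊆x ⊆y _ _ {y j} {y l} q =
    <⇒before-y Su′ (⊆y (before⇒∈ˡ q)) (⊆y (before⇒∈ʳ q)) (proj₂ (proj₂ Su) q)
  before-⊆ Su Su′ ⊆x ⊆y ⊆i _ {y j} {x k} q = ⊆i q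
  before-⊆ (U , _) Su′ ⊆x ⊆y _ ⊇i {x k} {y j} q
    with before-total (⊆x (before⇒∈ˡ q)) (⊆y (before⇒∈ʳ q)) (λ ())
  ... | inj₁ r = r
  ... | inj₂ r = ⊥-elim (before-asym U q (⊇i r))

  shuffle-≡ : ∀ {u u′} → IsShuffle u → IsShuffle u′
            → u ⊆ₓ u′ → u′ ⊆ₓ u → u ⊆ᵧ u′ → u′ ⊆ᵧ u → u ⊆ᵢ u′ → u′ ⊆ᵢ u → u ≡ u′
  shuffle-≡ Su Su′ ⊆x ⊇x ⊆y ⊇y ⊆i ⊇i =
    ≡-from-before _≟ₗ_ (proj₁ Su) (proj₁ Su′) (letters-⊆ ⊆x ⊆y) (letters-⊆ ⊇x ⊇y)
                  (before-⊆ Su Su′ ⊆x ⊆y ⊆i ⊇i)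

  ≡-top : ∀ {w u} → IsShuffle w → IsShuffle u → w ≤bub u → w ⊆ₓ u → u ⊆ᵧ w → u ⊆ᵢ w → w ≡ u
  ≡-top Sw Su w≤u ⊆x ⊇y ⊇i =
    shuffle-≡ Sw Su ⊆x (x-antitone w≤u) (y-monotone w≤u) ⊇y
              (λ q → inversion-monotone w≤u q (⊆x (before⇒∈ʳ q))) ⊇i

  ≡-bottom : ∀ {v w} → IsShuffle v → IsShuffle w → v ≤bub w → v ⊆ₓ w → w ⊆ᵧ v → w ⊆ᵢ v → w ≡ v
  ≡-bottom Sv Sw v≤w ⊆x ⊇y ⊇i =
    shuffle-≡ Sw Sv (x-antitone v≤w) ⊆x ⊇y (y-monotone v≤w) ⊇i
              (λ q → inversion-monotone v≤w q (⊆x (before⇒∈ʳ q)))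

  open import Data.List.Membership.DecPropositional _≟ₗ_ using (_∈?_)

  -- Covers

  Between : Word m n → Word m n → Set
  Between v u = ∀ w → IsShuffle w → v ≤bub w → w ≤bub u → w ≡ v ⊎ w ≡ u

  step-cover : ∀ {v u} → IsShuffle v → IsShuffle u → Step m n v u → Between v u → v ⋖ u
  step-cover Sv Su st between =
    IsShuffle⇒Shuf Sv , IsShuffle⇒Shuf Su , st ◅ ε , step⇒≢ st , λ w Sw → between w (Shuf⇒IsShuffle Sw)

  data StartsAbove (i : Fin m) : Word m n → Set where
    empty  : StartsAbove i []
    next-x : ∀ {k s} → i Fin.< k → StartsAbove i (x k ∷ s)

  insertion-slot : ∀ (u : Word m n) i → x i ∉ u → Σ (Word m n) λ p → Σ (Word m n) λ s →
                   u ≡ p ++ s × (∀ {k} → x k ∈ p → k Fin.< i) × StartsAbove i s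
  insertion-slot [] i _ = [] , [] , refl , (λ ()) , empty
  insertion-slot (y j ∷ t) i xi∉ with insertion-slot t i (λ xi∈t → xi∉ (there xi∈t))
  ... | p , s , t≡ , below , above = y j ∷ p , s , cong (y j ∷_) t≡ , (λ { (there xk∈p) → below xk∈p }) , above
  insertion-slot (x k ∷ t) i xi∉ with i Fin.<? k
  ... | yes i<k = [] , x k ∷ t , refl , (λ ()) , next-x i<k
  ... | no  i≮k with insertion-slot t i (λ xi∈t → xi∉ (there xi∈t))
  ...   | p , s , t≡ , below , above = x k ∷ p , s , cong (x k ∷_) t≡ , below′ , above
    where
    k<i : k Fin.< i
    k<i = ℕ.≤∧≢⇒< (ℕ.≮⇒≥ i≮k) (λ e → xi∉ (here (cong x (sym (Fin.toℕ-injective e)))))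
    below′ : ∀ {k′} → x k′ ∈ x k ∷ p → k′ Fin.< i
    below′ (here refl)   = k<i
    below′ (there xk∈p) = below xk∈p

  module ReinsertX {p s : Word m n} {i : Fin m} (Su : IsShuffle (p ++ s)) (xi∉ : x i ∉ p ++ s)
                   (below : ∀ {k} → x k ∈ p → k Fin.< i) (above : StartsAbove i s) where

    c : Word m n
    c = p ++ x i ∷ s

    U : NoRepeats c
    U = NoRepeats-insert _≟ₗ_ p (proj₁ Su) xi∉

    x-increasing : XIncreasing c
    x-increasing {a} {b} q with a Fin.≟ i | b Fin.≟ i
    ... | yes refl | _     = i<after above (proj₁ (proj₂ Su)) (before⇒∈-suffix p U q)
      where
      i<after : ∀ {s′} → StartsAbove i s′ → XIncreasing (p ++ s′) → x b ∈ s′ → i Fin.< b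
      i<after (next-x i<k) _ (here refl)  = i<k
      i<after (next-x i<k) X (there xb∈) = Fin.<-trans i<k (X (before-++⁺ʳ p (now xb∈)))
    ... | no _     | yes refl = below (before⇒∈-prefix p U q)
    ... | no a≢i   | no b≢i   =
      proj₁ (proj₂ Su) (before-remove⁺ p q (λ e → a≢i (x-injective e)) (λ e → b≢i (x-injective e)))

    shuffle : IsShuffle c
    shuffle = U , x-increasing , λ q → proj₂ (proj₂ Su) (before-remove⁺ p q (λ ()) (λ ()))

    -- If nothing follows x_i in c then y_l lies in p; otherwise y_l precedes, in w and hence in c,
    -- the x-letter that follows x_i in c.
    inversion-onto-xi : ∀ {s′ w l} → StartsAbove i s′ → NoRepeats (p ++ x i ∷ s′) → IsShuffle w
                      → x i ∈ w → w ≤bub (p ++ s′) → Before (y l) (x i) w → Before (y l) (x i) (p ++ x i ∷ s′)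
    inversion-onto-xi empty _ _ _ w≤u q with ∈-++⁻ p (y-monotone w≤u (before⇒∈ˡ q))
    ... | inj₁ yl∈p = before-++⁺ yl∈p (here refl)
    ... | inj₂ ()
    inversion-onto-xi (next-x i<k) U′ Sw xi∈w w≤u q =
      before-successor⇒before p U′
        (before-insert⁺ p (inversion-monotone w≤u yl-before-xk (∈-insert p))) (λ ())
      where
      yl-before-xk = before-trans (proj₁ Sw) q (<⇒before-x Sw xi∈w (x-antitone w≤u (∈-insert p)) i<k)

    between : Between c (p ++ s)
    between w Sw c≤w w≤u with x i ∈? w
    ... | no xi∉w = inj₂ (≡-top Sw Su w≤u w⊆ₓu u⊆ᵧw u⊆ᵢw)
      where
      w⊆ₓu : w ⊆ₓ (p ++ s)
      w⊆ₓu xk∈ = ∈-remove⁺ p (x-antitone c≤w xk∈) (λ e → xi∉w (subst (_∈ w) e xk∈))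
      u⊆ᵧw : (p ++ s) ⊆ᵧ w
      u⊆ᵧw yl∈ = y-monotone c≤w (∈-insert⁺ p yl∈)
      u⊆ᵢw : (p ++ s) ⊆ᵢ w
      u⊆ᵢw q = inversion-monotone c≤w (before-insert⁺ p q) (x-antitone w≤u (before⇒∈ʳ q))
    ... | yes xi∈w = inj₁ (≡-bottom shuffle Sw c≤w c⊆ₓw w⊆ᵧc w⊆ᵢc)
      where
      c⊆ₓw : c ⊆ₓ w
      c⊆ₓw {k} xk∈ with k Fin.≟ i
      ... | yes refl = xi∈w
      ... | no k≢i   = x-antitone w≤u (∈-remove⁺ p xk∈ (λ e → k≢i (x-injective e)))
      w⊆ᵧc : w ⊆ᵧ c
      w⊆ᵧc yl∈ = ∈-insert⁺ p (y-monotone w≤u yl∈)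
      w⊆ᵢc : w ⊆ᵢ c
      w⊆ᵢc {k = k} q with k Fin.≟ i
      ... | yes refl = inversion-onto-xi above U Sw xi∈w w≤u q
      ... | no k≢i   = before-insert⁺ p (inversion-monotone w≤u q
                         (∈-remove⁺ p (x-antitone c≤w (before⇒∈ʳ q)) (λ e → k≢i (x-injective e))))

    cover : c ⋖ (p ++ s)
    cover = step-cover shuffle Su (delete-step p shuffle Su) between

  cover-reinserting-x : ∀ {u i} → IsShuffle u → x i ∉ u
                      → ∃ λ c → c ⋖ u × x i ∈ c × (∀ {k} → x k ∈ c → k ≢ i → x k ∈ u)
  cover-reinserting-x {u} {i} Su xi∉ with insertion-slot u i xi∉
  ... | p , s , refl , below , above =
    p ++ x i ∷ s , ReinsertX.cover Su xi∉ below above , ∈-insert p ,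
    λ xk∈ k≢i → ∈-remove⁺ p xk∈ (λ e → k≢i (x-injective e))

  record LowersY (u : Word m n) (j : Fin n) (c : Word m n) : Set where
    field
      covered          : c ⋖ u
      x-letters-⊆      : c ⊆ₓ u
      loses-y          : y j ∉ c ⊎ ∃ λ k → Before (y j) (x k) u × ¬ Before (y j) (x k) c
      keeps-y          : ∀ {l} → l ≢ j → y l ∈ u → y l ∈ c
      keeps-inversions : ∀ {l k} → l ≢ j → Before (y l) (x k) u → Before (y l) (x k) c

  module SwapBack (p s : Word m n) (j : Fin n) (k : Fin m) (Su : IsShuffle (p ++ y j ∷ x k ∷ s)) where

    u c : Word m n
    u = p ++ y j ∷ x k ∷ s
    c = p ++ x k ∷ y j ∷ s

    U : NoRepeats c
    U a q = proj₁ Su a (before-swap⁺ p q (λ { (refl , ()) }))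

    shuffle : IsShuffle c
    shuffle = U , (λ q → proj₁ (proj₂ Su) (before-swap⁺ p q (λ { (_ , ()) })))
                , (λ q → proj₂ (proj₂ Su) (before-swap⁺ p q (λ { (() , _) })))

    yj-xk : Before (y j) (x k) u
    yj-xk = before-++⁺ʳ p (now (here refl))

    inversion-≟ : ∀ l k′ → Dec (y {m} l ≡ y j × x {m} {n} k′ ≡ x k)
    inversion-≟ l k′ = (y l ≟ₗ y j) ×-dec (x k′ ≟ₗ x k)

    between : Between c u
    between w Sw c≤w w≤u
      with before-total (x-antitone w≤u (∈-swap⁺ p (∈-insert p))) (y-monotone c≤w (∈-swap⁺ p (∈-insert p))) (λ ())
    ... | inj₁ xk-yj = inj₁ (≡-bottom shuffle Sw c≤w c⊆ₓw w⊆ᵧc w⊆ᵢc)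
      where
      c⊆ₓw : c ⊆ₓ w
      c⊆ₓw xk′∈ = x-antitone w≤u (∈-swap⁺ p xk′∈)
      w⊆ᵧc : w ⊆ᵧ c
      w⊆ᵧc yl∈ = ∈-swap⁺ p (y-monotone w≤u yl∈)
      w⊆ᵢc : w ⊆ᵢ c
      w⊆ᵢc {l} {k′} q with inversion-≟ l k′
      ... | yes (refl , refl) = ⊥-elim (before-asym (proj₁ Sw) xk-yj q)
      ... | no other = before-swap⁺ p (inversion-monotone w≤u q (∈-swap⁺ p (x-antitone c≤w (before⇒∈ʳ q)))) other
    ... | inj₂ yj-xk-in-w = inj₂ (≡-top Sw Su w≤u w⊆ₓu u⊆ᵧw u⊆ᵢw)
      where
      w⊆ₓu : w ⊆ₓ u
      w⊆ₓu xk′∈ = ∈-swap⁺ p (x-antitone c≤w xk′∈)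
      u⊆ᵧw : u ⊆ᵧ w
      u⊆ᵧw yl∈ = y-monotone c≤w (∈-swap⁺ p yl∈)
      u⊆ᵢw : u ⊆ᵢ w
      u⊆ᵢw {l} {k′} q with inversion-≟ l k′
      ... | yes (refl , refl) = yj-xk-in-w
      ... | no other = inversion-monotone c≤w (before-swap⁺ p q other) (x-antitone w≤u (before⇒∈ʳ q))

    lowers : LowersY u j c
    lowers = record
      { covered          = step-cover shuffle Su (swap-step p shuffle Su) between
      ; x-letters-⊆      = ∈-swap⁺ p
      ; loses-y          = inj₂ (k , yj-xk , before-asym U (before-++⁺ʳ p (now (here refl))))
      ; keeps-y          = λ _ yl∈ → ∈-swap⁺ p yl∈
      ; keeps-inversions = λ l≢j q → before-swap⁺ p q (λ (e , _) → l≢j (y-injective e))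
      }

  module DeleteY (p s : Word m n) (j : Fin n) (Su : IsShuffle (p ++ y j ∷ s))
                 (guarded : ∀ {k} → x k ∈ s → ∃ λ l → y l ∈ s × Before (y l) (x k) s) where

    u c : Word m n
    u = p ++ y j ∷ s
    c = p ++ s

    shuffle : IsShuffle c
    shuffle = IsShuffle-remove p Su

    between : Between c u
    between w Sw c≤w w≤u with y j ∈? w
    ... | no yj∉w = inj₁ (≡-bottom shuffle Sw c≤w c⊆ₓw w⊆ᵧc w⊆ᵢc)
      where
      yl≢yj : ∀ {l} → y l ∈ w → y l ≢ y j
      yl≢yj yl∈ e = yj∉w (subst (_∈ w) e yl∈)
      c⊆ₓw : c ⊆ₓ w
      c⊆ₓw xk∈ = x-antitone w≤u (∈-insert⁺ p xk∈)
      w⊆ᵧc : w ⊆ᵧ c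
      w⊆ᵧc yl∈ = ∈-remove⁺ p (y-monotone w≤u yl∈) (yl≢yj yl∈)
      w⊆ᵢc : w ⊆ᵢ c
      w⊆ᵢc q = before-remove⁺ p (inversion-monotone w≤u q (∈-insert⁺ p (x-antitone c≤w (before⇒∈ʳ q))))
                               (yl≢yj (before⇒∈ˡ q)) (λ ())
    ... | yes yj∈w = inj₂ (≡-top Sw Su w≤u w⊆ₓu u⊆ᵧw u⊆ᵢw)
      where
      w⊆ₓu : w ⊆ₓ u
      w⊆ₓu xk∈ = ∈-insert⁺ p (x-antitone c≤w xk∈)
      u⊆ᵧw : u ⊆ᵧ w
      u⊆ᵧw {l} yl∈ with l Fin.≟ j
      ... | yes refl = yj∈w
      ... | no l≢j   = y-monotone c≤w (∈-remove⁺ p yl∈ (λ e → l≢j (y-injective e)))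
      -- y_j precedes the y-letter guarding x_k, which precedes x_k in c and hence in w.
      u⊆ᵢw : u ⊆ᵢ w
      u⊆ᵢw {l} q with l Fin.≟ j
      ... | no l≢j = inversion-monotone c≤w (before-remove⁺ p q (λ e → l≢j (y-injective e)) (λ ()))
                                            (x-antitone w≤u (before⇒∈ʳ q))
      ... | yes refl with guarded (before⇒∈-suffix p (proj₁ Su) q)
      ...   | l′ , yl′∈s , yl′-xk =
        before-trans (proj₁ Sw)
          (<⇒before-y Sw yj∈w (y-monotone c≤w (∈-++⁺ʳ p yl′∈s)) (proj₂ (proj₂ Su) (before-++⁺ʳ p (now yl′∈s))))
          (inversion-monotone c≤w (before-++⁺ʳ p yl′-xk) (x-antitone w≤u (before⇒∈ʳ q)))

    lowers : LowersY u j c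
    lowers = record
      { covered          = step-cover shuffle Su (insert-step p Su shuffle) between
      ; x-letters-⊆      = ∈-insert⁺ p
      ; loses-y          = inj₁ (NoRepeats⇒∉-removed p (proj₁ Su))
      ; keeps-y          = λ l≢j yl∈ → ∈-remove⁺ p yl∈ (λ e → l≢j (y-injective e))
      ; keeps-inversions = λ l≢j q → before-remove⁺ p q (λ e → l≢j (y-injective e)) (λ ())
      }

  cover-lowering-y : ∀ {u j} → IsShuffle u → y j ∈ u → ∃ λ c → LowersY u j c
  cover-lowering-y {u} {j} Su yj∈ with ∈-∃++ yj∈
  ... | p , []      , refl = p ++ [] , DeleteY.lowers p [] j Su (λ ())
  ... | p , x k ∷ s , refl = p ++ x k ∷ y j ∷ s , SwapBack.lowers p s j k Su
  ... | p , y l ∷ s , refl = p ++ y l ∷ s , DeleteY.lowers p (y l ∷ s) j Su guarded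
    where
    guarded : ∀ {k} → x k ∈ y l ∷ s → ∃ λ l′ → y l′ ∈ y l ∷ s × Before (y l′) (x k) (y l ∷ s)
    guarded (there xk∈s) = l , here refl , now xk∈s

-- Join-irreducible elements

module _ {m n : ℕ} where
  open import Data.List.Membership.DecPropositional (_≟ₗ_ {m} {n}) using (_∈?_; _∉?_)

  YFree : Word m n → Set
  YFree u = ∀ l → y l ∉ u

  IsShuffle-insert-y : ∀ p {j s} → IsShuffle (p ++ s) → YFree (p ++ s) → IsShuffle (p ++ y j ∷ s)
  IsShuffle-insert-y p {j} (U , X , _) y-free =
    NoRepeats-insert _≟ₗ_ p U (y-free j) , (λ q → X (before-remove⁺ p q (λ ()) (λ ()))) , only-yj-increasing
    where
    only-yj : ∀ {l} → y l ∈ p ++ y j ∷ _ → l ≡ j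
    only-yj yl∈ with ∈-++⁻ p yl∈
    ... | inj₁ yl∈p         = ⊥-elim (y-free _ (∈-++⁺ˡ yl∈p))
    ... | inj₂ (here e)     = y-injective e
    ... | inj₂ (there yl∈s) = ⊥-elim (y-free _ (∈-++⁺ʳ p yl∈s))
    only-yj-increasing : YIncreasing (p ++ y j ∷ _)
    only-yj-increasing q with only-yj (before⇒∈ˡ q) | only-yj (before⇒∈ʳ q)
    ... | refl | refl = ⊥-elim (NoRepeats-insert _≟ₗ_ p U (y-free j) _ q)

  y-free-≡ : ∀ {u u′} → IsShuffle u → IsShuffle u′ → YFree u → YFree u′ → u ⊆ₓ u′ → u′ ⊆ₓ u → u ≡ u′
  y-free-≡ Su Su′ free free′ ⊆x ⊇x =
    shuffle-≡ Su Su′ ⊆x ⊇x (λ {l} yl∈ → ⊥-elim (free l yl∈)) (λ {l} yl∈ → ⊥-elim (free′ l yl∈))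
              (λ q → ⊥-elim (free _ (before⇒∈ˡ q))) (λ q → ⊥-elim (free′ _ (before⇒∈ˡ q)))

  bottom : Word m n
  bottom = tabulate x

  x∈bottom : ∀ k → x k ∈ bottom
  x∈bottom = ∈-tabulate⁺

  bottom-y-free : YFree bottom
  bottom-y-free l yl∈ with ∈-tabulate⁻ yl∈
  ... | _ , ()

  bottom-shuffle : IsShuffle bottom
  bottom-shuffle =
    Unique⇒NoRepeats (Unique.tabulate⁺ x-injective) ,
    (λ q → AllPairs⇒before x-sorted q refl refl) ,
    (λ q → ⊥-elim (bottom-y-free _ (before⇒∈ˡ q)))
    where
    x-sorted : AllPairs (λ a b → ∀ {i k} → a ≡ x i → b ≡ x k → i Fin.< k) bottom
    x-sorted = AllPairs.tabulate⁺-< λ { i<k refl refl → i<k }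

  length-bottom : length bottom ≡ m
  length-bottom = List.length-tabulate x

  record LacksOnlyX (i : Fin m) (w : Word m n) : Set where
    field
      shuffle : IsShuffle w
      lacks   : x i ∉ w
      others  : ∀ k → k ≢ i → x k ∈ w
      y-free  : YFree w

  record HasOnlyY (j : Fin n) (w : Word m n) : Set where
    field
      shuffle : IsShuffle w
      has-y   : y j ∈ w
      all-x   : ∀ k → x k ∈ w
      only-y  : ∀ l → y l ∈ w → l ≡ j

  bottom-without : Fin m → Word m n
  bottom-without i = proj₁ (∈-∃++ (x∈bottom i)) ++ proj₁ (proj₂ (∈-∃++ (x∈bottom i)))

  bottom-without-lacks-only : ∀ i → LacksOnlyX i (bottom-without i)
  bottom-without-lacks-only i with ∈-∃++ (x∈bottom i)
  ... | p , s , bottom≡ = record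
    { shuffle = IsShuffle-remove p S
    ; lacks   = NoRepeats⇒∉-removed p (proj₁ S)
    ; others  = λ k k≢i → ∈-remove⁺ p (subst (x k ∈_) bottom≡ (x∈bottom k)) (λ e → k≢i (x-injective e))
    ; y-free  = λ l yl∈ → bottom-y-free l (subst (y l ∈_) (sym bottom≡) (∈-insert⁺ p yl∈))
    }
    where
    S : IsShuffle (p ++ x i ∷ s)
    S = subst IsShuffle bottom≡ bottom-shuffle

  lacks-only⇒≡bottom-without : ∀ {i u} → LacksOnlyX i u → u ≡ bottom-without i
  lacks-only⇒≡bottom-without {i} {u} L = y-free-≡ (shuffle L) (shuffle B) (y-free L) (y-free B) u⊆ B⊆
    where
    open LacksOnlyX
    B = bottom-without-lacks-only i
    u⊆ : u ⊆ₓ bottom-without i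
    u⊆ {k} xk∈ with k Fin.≟ i
    ... | yes refl = ⊥-elim (lacks L xk∈)
    ... | no k≢i   = others B k k≢i
    B⊆ : bottom-without i ⊆ₓ u
    B⊆ {k} xk∈ with k Fin.≟ i
    ... | yes refl = ⊥-elim (lacks B xk∈)
    ... | no k≢i   = others L k k≢i

  bottom-with : Fin n → ℕ → Word m n
  bottom-with j p = insert-at p (y j) bottom

  bottom-with-has-only : ∀ j p → HasOnlyY j (bottom-with j p)
  bottom-with-has-only j p with insert-at-split p (y j) bottom
  ... | a , b , ins≡ , ab≡ rewrite ins≡ = record
    { shuffle = IsShuffle-insert-y a (subst IsShuffle (sym ab≡) bottom-shuffle) y-free
    ; has-y   = ∈-insert a
    ; all-x   = λ k → ∈-insert⁺ a (subst (x k ∈_) (sym ab≡) (x∈bottom k))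
    ; only-y  = only-y
    }
    where
    y-free : YFree (a ++ b)
    y-free l yl∈ = bottom-y-free l (subst (y l ∈_) ab≡ yl∈)
    only-y : ∀ l → y l ∈ a ++ y j ∷ b → l ≡ j
    only-y l yl∈ with ∈-++⁻ a yl∈
    ... | inj₁ yl∈a         = ⊥-elim (y-free l (∈-++⁺ˡ yl∈a))
    ... | inj₂ (here e)     = y-injective e
    ... | inj₂ (there yl∈b) = ⊥-elim (y-free l (∈-++⁺ʳ a yl∈b))

  has-only⇒≡bottom-with : ∀ {j u} → HasOnlyY j u → Σ ℕ λ p → p ℕ.≤ m × u ≡ bottom-with j p
  has-only⇒≡bottom-with {j} H with ∈-∃++ (HasOnlyY.has-y H)
  ... | a , b , refl = length a , length-a≤m , insert-at-length a b ab≡bottom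
    where
    open HasOnlyY H
    y-free : YFree (a ++ b)
    y-free l yl∈ with only-y l (∈-insert⁺ a yl∈)
    ... | refl = NoRepeats⇒∉-removed a (proj₁ shuffle) yl∈
    ab≡bottom : a ++ b ≡ bottom
    ab≡bottom = y-free-≡ (IsShuffle-remove a shuffle) bottom-shuffle y-free bottom-y-free
                         (λ {k} _ → x∈bottom k) (λ {k} _ → ∈-remove⁺ a (all-x k) (λ ()))
    length-a≤m : length a ℕ.≤ m
    length-a≤m = begin
      length a            ≤⟨ ℕ.m≤m+n (length a) (length b) ⟩
      length a + length b ≡⟨ sym (List.length-++ a) ⟩
      length (a ++ b)     ≡⟨ cong length ab≡bottom ⟩
      length bottom       ≡⟨ length-bottom ⟩
      m                   ∎
      where open ℕ.≤-Reasoning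

  has-only-y-twice : ∀ {j} pre {l rest} → ¬ HasOnlyY j (pre ++ y l ∷ y j ∷ rest)
  has-only-y-twice pre {l} H with HasOnlyY.only-y H l (∈-insert pre)
  ... | refl = proj₁ (HasOnlyY.shuffle H) _ (before-++⁺ʳ pre (now (here refl)))

  bottom-with-step : ∀ j {p} → suc p ℕ.≤ m → Step m n (bottom-with j (suc p)) (bottom-with j p)
  bottom-with-step j {p} p<m with insert-at-suc p (y j) bottom (subst (suc p ℕ.≤_) (sym length-bottom) p<m)
  ... | pre , x k , rest , e₁ , e₂ =
    subst₂ (Step m n) (sym e₁) (sym e₂)
      (swap-step pre (subst IsShuffle e₁ (HasOnlyY.shuffle (bottom-with-has-only j (suc p))))
                     (subst IsShuffle e₂ (HasOnlyY.shuffle (bottom-with-has-only j p))))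
  ... | pre , y l , rest , e₁ , _ =
    ⊥-elim (has-only-y-twice pre (subst (HasOnlyY j) e₁ (bottom-with-has-only j (suc p))))

  bottom-step : ∀ j → Step m n bottom (bottom-with j m)
  bottom-step j = subst₂ (Step m n) (List.++-identityʳ bottom) (sym at-end)
    (insert-step bottom (subst IsShuffle at-end (HasOnlyY.shuffle (bottom-with-has-only j m)))
                        (subst IsShuffle (sym (List.++-identityʳ bottom)) bottom-shuffle))
    where
    at-end : bottom-with j m ≡ bottom ++ y j ∷ []
    at-end = subst (λ t → insert-at t (y j) bottom ≡ bottom ++ y j ∷ []) length-bottom (insert-at-end (y j) bottom)

  bottom-with-antitone : ∀ j {p} q → p ℕ.≤ q → q ℕ.≤ m → bottom-with j q ≤bub bottom-with j p
  bottom-with-antitone j {zero} zero z≤n _ = ε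
  bottom-with-antitone j {p} (suc q) p≤ q<m with p ℕ.≟ suc q
  ... | yes refl = ε
  ... | no p≢ = bottom-with-step j q<m ◅ bottom-with-antitone j q (ℕ.s≤s⁻¹ (ℕ.≤∧≢⇒< p≤ p≢)) (ℕ.<⇒≤ q<m)

  bottom≤bottom-with : ∀ j {q} → q ℕ.≤ m → bottom ≤bub bottom-with j q
  bottom≤bottom-with j q≤m = bottom-step j ◅ bottom-with-antitone j m q≤m ℕ.≤-refl

  bottom-with-injective : ∀ j {p p′} → p ℕ.≤ m → p′ ℕ.≤ m → bottom-with j p ≡ bottom-with j p′ → p ≡ p′
  bottom-with-injective j p≤m p′≤m =
    insert-at-injective bottom (bottom-y-free j) (subst (_ ℕ.≤_) (sym length-bottom) p≤m)
                                                 (subst (_ ℕ.≤_) (sym length-bottom) p′≤m)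

  covers-agree⇒JoinIrreducible : ∀ {u c d} → IsShuffle u → c ⋖ u → (∀ {w} → w ⋖ u → w ≡ d)
                               → JoinIrreducible m n u
  covers-agree⇒JoinIrreducible Su c⋖u agree =
    IsShuffle⇒Shuf Su , _ , c⋖u , λ w w⋖u → trans (agree w⋖u) (sym (agree c⋖u))

  cover-of-bottom-without : ∀ {w} i → w ⋖ bottom-without i → w ≡ bottom
  cover-of-bottom-without {w} i (Sw , _ , w≤ , w≢ , _) with x i ∈? w
  ... | yes xi∈w = y-free-≡ (Shuf⇒IsShuffle Sw) bottom-shuffle w-free bottom-y-free (λ {k} _ → x∈bottom k) bottom⊆w
    where
    open LacksOnlyX (bottom-without-lacks-only i)
    w-free : YFree w
    w-free l yl∈ = y-free l (y-monotone w≤ yl∈)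
    bottom⊆w : bottom ⊆ₓ w
    bottom⊆w {k} _ with k Fin.≟ i
    ... | yes refl = xi∈w
    ... | no k≢i   = x-antitone w≤ (others k k≢i)
  ... | no xi∉w = ⊥-elim (w≢ (lacks-only⇒≡bottom-without (record
    { shuffle = Shuf⇒IsShuffle Sw
    ; lacks   = xi∉w
    ; others  = λ k k≢i → x-antitone w≤ (others k k≢i)
    ; y-free  = λ l yl∈ → y-free l (y-monotone w≤ yl∈)
    })))
    where open LacksOnlyX (bottom-without-lacks-only i)

  bottom-without-join-irreducible : ∀ i → JoinIrreducible m n (bottom-without i)
  bottom-without-join-irreducible i =
    covers-agree⇒JoinIrreducible shuffle (proj₁ (proj₂ (cover-reinserting-x shuffle lacks))) (cover-of-bottom-without i)
    where open LacksOnlyX (bottom-without-lacks-only i)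

  below-bottom-with : ∀ {w} j {p} → p ℕ.≤ m → w ⋖ bottom-with j p
                    → w ≡ bottom ⊎ Σ ℕ λ q → p ℕ.< q × q ℕ.≤ m × w ≡ bottom-with j q
  below-bottom-with {w} j {p} p≤m (Sw , _ , w≤ , w≢ , _) with y j ∈? w
  ... | no yj∉w = inj₁ (y-free-≡ (Shuf⇒IsShuffle Sw) bottom-shuffle w-free bottom-y-free
                                 (λ {k} _ → x∈bottom k) (λ {k} _ → x-antitone w≤ (all-x k)))
    where
    open HasOnlyY (bottom-with-has-only j p)
    w-free : YFree w
    w-free l yl∈ with only-y l (y-monotone w≤ yl∈)
    ... | refl = yj∉w yl∈
  ... | yes yj∈w with has-only⇒≡bottom-with (record
    { shuffle = Shuf⇒IsShuffle Sw
    ; has-y   = yj∈w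
    ; all-x   = λ k → x-antitone w≤ (all-x k)
    ; only-y  = λ l yl∈ → only-y l (y-monotone w≤ yl∈)
    })
    where open HasOnlyY (bottom-with-has-only j p)
  ...   | q , q≤m , refl with q ℕ.≤? p
  ...     | yes q≤p = ⊥-elim (w≢ (≤bub-antisym w≤ (bottom-with-antitone j p q≤p p≤m)))
  ...     | no q≰p  = inj₂ (q , ℕ.≰⇒> q≰p , q≤m , refl)

  next-below : Fin n → ℕ → Word m n
  next-below j p with suc p ℕ.≤? m
  ... | yes _ = bottom-with j (suc p)
  ... | no _  = bottom

  cover-below-bottom-with-suc : ∀ {w} j {p} → p ℕ.≤ m → suc p ℕ.≤ m → w ⋖ bottom-with j p
                              → w ≤bub bottom-with j (suc p) → w ≡ bottom-with j (suc p)
  cover-below-bottom-with-suc j {p} p≤m p<m (_ , _ , _ , _ , between) w≤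
    with between _ (IsShuffle⇒Shuf (HasOnlyY.shuffle (bottom-with-has-only j (suc p)))) w≤ (bottom-with-step j p<m ◅ ε)
  ... | inj₁ e = sym e
  ... | inj₂ e = ⊥-elim (ℕ.1+n≢n (bottom-with-injective j p<m p≤m e))

  cover-of-bottom-with : ∀ {w} j {p} → p ℕ.≤ m → w ⋖ bottom-with j p → w ≡ next-below j p
  cover-of-bottom-with j {p} p≤m w⋖ with suc p ℕ.≤? m | below-bottom-with j p≤m w⋖
  ... | yes p<m | inj₁ refl =
    ⊥-elim (bottom-y-free j (subst (y j ∈_) (sym (cover-below-bottom-with-suc j p≤m p<m w⋖ (bottom≤bottom-with j p<m)))
                                   (HasOnlyY.has-y (bottom-with-has-only j (suc p)))))
  ... | yes p<m | inj₂ (q , p<q , q≤m , refl) =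
    cover-below-bottom-with-suc j p≤m p<m w⋖ (bottom-with-antitone j q p<q q≤m)
  ... | no _    | inj₁ w≡bottom              = w≡bottom
  ... | no p≮m | inj₂ (q , p<q , q≤m , _)   = ⊥-elim (p≮m (ℕ.≤-trans p<q q≤m))

  bottom-with-join-irreducible : ∀ j {p} → p ℕ.≤ m → JoinIrreducible m n (bottom-with j p)
  bottom-with-join-irreducible j {p} p≤m =
    covers-agree⇒JoinIrreducible shuffle (LowersY.covered (proj₂ (cover-lowering-y shuffle has-y)))
                                 (cover-of-bottom-with j p≤m)
    where open HasOnlyY (bottom-with-has-only j p)

  no-missing-x⇒all-x : ∀ {u} → ¬ (∃ λ i → x i ∉ u) → ∀ k → x k ∈ u
  no-missing-x⇒all-x {u} none-missing k = decidable-stable (x k ∈? u) (λ xk∉ → none-missing (k , xk∉))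

  module _ {u : Word m n} (ji : JoinIrreducible m n u) where

    Su : IsShuffle u
    Su = Shuf⇒IsShuffle (proj₁ ji)

    unique-cover : ∀ {c₁ c₂} → c₁ ⋖ u → c₂ ⋖ u → c₁ ≡ c₂
    unique-cover c₁⋖ c₂⋖ = trans (proj₂ (proj₂ (proj₂ ji)) _ c₁⋖) (sym (proj₂ (proj₂ (proj₂ ji)) _ c₂⋖))

    missing-x⇒y-free : ∀ {i} → x i ∉ u → YFree u
    missing-x⇒y-free {i} xi∉ j yj∈ with cover-reinserting-x Su xi∉ | cover-lowering-y Su yj∈
    ... | c₁ , c₁⋖ , xi∈c₁ , _ | c₂ , L =
      xi∉ (x-letters-⊆ (subst (x i ∈_) (unique-cover c₁⋖ covered) xi∈c₁))
      where open LowersY L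

    missing-x-unique : ∀ {i k} → x i ∉ u → x k ∉ u → k ≡ i
    missing-x-unique {i} {k} xi∉ xk∉ with k Fin.≟ i
    ... | yes k≡i = k≡i
    ... | no k≢i with cover-reinserting-x Su xi∉ | cover-reinserting-x Su xk∉
    ...   | c₁ , c₁⋖ , xi∈c₁ , _ | c₂ , c₂⋖ , _ , others =
      ⊥-elim (xi∉ (others (subst (x i ∈_) (unique-cover c₁⋖ c₂⋖) xi∈c₁) (λ i≡k → k≢i (sym i≡k))))

    present-y-unique : ∀ {j l} → y j ∈ u → y l ∈ u → l ≡ j
    present-y-unique {j} {l} yj∈ yl∈ with l Fin.≟ j
    ... | yes l≡j = l≡j
    ... | no l≢j with cover-lowering-y Su yj∈ | cover-lowering-y Su yl∈
    ...   | c₁ , L₁ | c₂ , L₂ with LowersY.loses-y L₁ | unique-cover (LowersY.covered L₁) (LowersY.covered L₂)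
    ...     | inj₁ yj∉c₁ | refl = ⊥-elim (yj∉c₁ (LowersY.keeps-y L₂ (λ j≡l → l≢j (sym j≡l)) yj∈))
    ...     | inj₂ (k , yj-xk , ¬yj-xk) | refl = ⊥-elim (¬yj-xk (LowersY.keeps-inversions L₂ (λ j≡l → l≢j (sym j≡l)) yj-xk))

    not-bottom : (∀ k → x k ∈ u) → ¬ YFree u
    not-bottom all-x free with proj₁ (proj₂ (proj₂ ji))
    ... | Sv , _ , v≤u , v≢u , _ =
      v≢u (y-free-≡ (Shuf⇒IsShuffle Sv) Su (λ l yl∈ → free l (y-monotone v≤u yl∈)) free
                    (λ {k} _ → all-x k) (x-antitone v≤u))

    shape : (∃ λ i → u ≡ bottom-without i) ⊎ (∃ λ j → Σ ℕ λ p → p ℕ.≤ m × u ≡ bottom-with j p)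
    shape with Fin.any? (λ i → x i ∉? u)
    ... | yes (i , xi∉) = inj₁ (i , lacks-only⇒≡bottom-without (record
      { shuffle = Su
      ; lacks   = xi∉
      ; others  = λ k k≢i → decidable-stable (x k ∈? u) (λ xk∉ → k≢i (missing-x-unique xi∉ xk∉))
      ; y-free  = missing-x⇒y-free xi∉
      }))
    ... | no none-missing with Fin.any? (λ j → y j ∈? u)
    ...   | yes (j , yj∈)   = inj₂ (j , has-only⇒≡bottom-with (record
      { shuffle = Su
      ; has-y   = yj∈
      ; all-x   = no-missing-x⇒all-x none-missing
      ; only-y  = λ l yl∈ → present-y-unique yj∈ yl∈
      }))
    ...   | no none-present = ⊥-elim (not-bottom (no-missing-x⇒all-x none-missing) (λ l yl∈ → none-present (l , yl∈)))

  bottom-with-at : Fin n × Fin (suc m) → Word m n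
  bottom-with-at (j , p) = bottom-with j (toℕ p)

  join-irreducibles : List (Word m n)
  join-irreducibles = map bottom-without (allFin m) ++ map bottom-with-at (cartesianProduct (allFin n) (allFin (suc m)))

  toℕ≤m : (p : Fin (suc m)) → toℕ p ℕ.≤ m
  toℕ≤m p = ℕ.s≤s⁻¹ (Fin.toℕ<n p)

  ∈join-irreducibles⇒ : ∀ {u} → u ∈ join-irreducibles → JoinIrreducible m n u
  ∈join-irreducibles⇒ u∈ with ∈-++⁻ (map bottom-without (allFin m)) u∈
  ... | inj₁ u∈₁ with ∈-map⁻ bottom-without u∈₁
  ...   | i , _ , refl = bottom-without-join-irreducible i
  ∈join-irreducibles⇒ u∈ | inj₂ u∈₂ with ∈-map⁻ bottom-with-at u∈₂
  ...   | (j , p) , _ , refl = bottom-with-join-irreducible j (toℕ≤m p)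

  ⇒∈join-irreducibles : ∀ {u} → JoinIrreducible m n u → u ∈ join-irreducibles
  ⇒∈join-irreducibles ji with shape ji
  ... | inj₁ (i , refl) = ∈-++⁺ˡ (∈-map⁺ bottom-without (∈-allFin i))
  ... | inj₂ (j , p , p≤m , refl) =
    ∈-++⁺ʳ (map bottom-without (allFin m))
      (subst (_∈ _) (cong (bottom-with j) (Fin.toℕ-fromℕ< (s≤s p≤m)))
        (∈-map⁺ bottom-with-at (∈-cartesianProduct⁺ (∈-allFin j) (∈-allFin (Fin.fromℕ< (s≤s p≤m))))))

  bottom-without-injective : ∀ {i i′} → bottom-without i ≡ bottom-without i′ → i ≡ i′
  bottom-without-injective {i} {i′} e with i Fin.≟ i′
  ... | yes i≡i′ = i≡i′
  ... | no i≢i′  = ⊥-elim (lacks (bottom-without-lacks-only i)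
                     (subst (x i ∈_) (sym e) (others (bottom-without-lacks-only i′) i i≢i′)))
    where open LacksOnlyX

  bottom-with-at-injective : ∀ {a b} → bottom-with-at a ≡ bottom-with-at b → a ≡ b
  bottom-with-at-injective {j , p} {j′ , p′} e
    with HasOnlyY.only-y (bottom-with-has-only j′ (toℕ p′)) j (subst (y j ∈_) e (HasOnlyY.has-y (bottom-with-has-only j (toℕ p))))
  ... | refl = cong (j ,_) (Fin.toℕ-injective (bottom-with-injective j (toℕ≤m p) (toℕ≤m p′) e))

  bottom-without≢bottom-with : ∀ {v} → ¬ (v ∈ map bottom-without (allFin m) × v ∈ map bottom-with-at (cartesianProduct (allFin n) (allFin (suc m))))
  bottom-without≢bottom-with (v∈₁ , v∈₂) with ∈-map⁻ bottom-without v∈₁ | ∈-map⁻ bottom-with-at v∈₂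
  ... | i , _ , refl | (j , p) , _ , e =
    LacksOnlyX.y-free (bottom-without-lacks-only i) j (subst (y j ∈_) (sym e) (HasOnlyY.has-y (bottom-with-has-only j (toℕ p))))

  join-irreducibles-unique : Unique join-irreducibles
  join-irreducibles-unique =
    Unique.++⁺ (Unique.map⁺ bottom-without-injective (Unique.allFin⁺ m))
               (Unique.map⁺ bottom-with-at-injective
                            (Unique.cartesianProductWith⁺ _,_ ,-injective (Unique.allFin⁺ n) (Unique.allFin⁺ (suc m))))
               bottom-without≢bottom-with

  length-join-irreducibles : length join-irreducibles ≡ m * n + m + n
  length-join-irreducibles = begin
    length join-irreducibles
      ≡⟨ List.length-++ (map bottom-without (allFin m)) ⟩
    length (map bottom-without (allFin m)) + length (map bottom-with-at pairs)
      ≡⟨ cong₂ _+_ (trans (List.length-map bottom-without (allFin m)) (length-allFin m))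
                   (trans (List.length-map bottom-with-at pairs) length-pairs) ⟩
    m + n * suc m
      ≡⟨ rearrange m n ⟩
    m * n + m + n ∎
    where
    open ≡-Reasoning
    pairs = cartesianProduct (allFin n) (allFin (suc m))
    length-pairs : length pairs ≡ n * suc m
    length-pairs = trans (length-cartesianProduct (allFin n) (allFin (suc m)))
                         (cong₂ _*_ (length-allFin n) (length-allFin (suc m)))
    rearrange : ∀ a b → a + b * suc a ≡ a * b + a + b
    rearrange = solve-∀

  join-irreducibles-count : HasExactly {m} {n} (m * n + m + n) (JoinIrreducible m n)
  join-irreducibles-count =
    join-irreducibles , join-irreducibles-unique , length-join-irreducibles ,
    λ u → mk⇔ ∈join-irreducibles⇒ ⇒∈join-irreducibles

-- Duality

flip-letter : ∀ {m n} → Letter m n → Letter n m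
flip-letter (x i) = y i
flip-letter (y j) = x j

flip : ∀ {m n} → Word m n → Word n m
flip = map flip-letter

flip-involutive : ∀ {m n} (u : Word m n) → flip (flip u) ≡ u
flip-involutive []        = refl
flip-involutive (x i ∷ u) = cong (x i ∷_) (flip-involutive u)
flip-involutive (y j ∷ u) = cong (y j ∷_) (flip-involutive u)

flip-injective : ∀ {m n} {a b : Word m n} → flip a ≡ flip b → a ≡ b
flip-injective {a = a} {b} e = trans (sym (flip-involutive a)) (trans (cong flip e) (flip-involutive b))

module _ {m n : ℕ} where

  flip-before⁻ : ∀ {a b : Letter n m} {u : Word m n} → Before a b (flip u) → Before (flip-letter a) (flip-letter b) u
  flip-before⁻ {u = u} q = subst (Before _ _) (flip-involutive u) (before-map⁺ flip-letter q)

  flip-shuffle : ∀ {u : Word m n} → IsShuffle u → IsShuffle (flip u)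
  flip-shuffle (U , X , Y) =
    (λ a q → U (flip-letter a) (flip-before⁻ q)) , (λ q → Y (flip-before⁻ q)) , (λ q → X (flip-before⁻ q))

  flip-++ : ∀ (p : Word m n) {s} → flip p ++ flip s ≡ flip (p ++ s)
  flip-++ p {s} = sym (List.map-++ flip-letter p s)

  flip-shuffle-++ : ∀ p {s : Word m n} → IsShuffle (p ++ s) → IsShuffle (flip p ++ flip s)
  flip-shuffle-++ p S = subst IsShuffle (sym (flip-++ p)) (flip-shuffle S)

  flip-step : ∀ {a b : Word m n} → Step m n a b → Step n m (flip b) (flip a)
  flip-step st with step⇒move st
  ... | Sa , Sb , delete-x p s i  =
    subst₂ (Step n m) (flip-++ p) (flip-++ p) (insert-step (flip p) (flip-shuffle-++ p Sa) (flip-shuffle-++ p Sb))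
  ... | Sa , Sb , insert-y p s j  =
    subst₂ (Step n m) (flip-++ p) (flip-++ p) (delete-step (flip p) (flip-shuffle-++ p Sb) (flip-shuffle-++ p Sa))
  ... | Sa , Sb , swap-xy p s i j =
    subst₂ (Step n m) (flip-++ p) (flip-++ p) (swap-step (flip p) (flip-shuffle-++ p Sb) (flip-shuffle-++ p Sa))

  flip-≤bub : ∀ {a b : Word m n} → a ≤bub b → flip b ≤bub flip a
  flip-≤bub ε        = ε
  flip-≤bub (st ◅ r) = flip-≤bub r ◅◅ (flip-step st ◅ ε)

flip-Shuf : ∀ {m n} {u : Word m n} → Shuf m n u → Shuf n m (flip u)
flip-Shuf S = IsShuffle⇒Shuf (flip-shuffle (Shuf⇒IsShuffle S))

flip-⋖ : ∀ {m n} {v u : Word m n} → v ⋖ u → flip u ⋖ flip v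
flip-⋖ {m} {n} {v} {u} (Sv , Su , v≤u , v≢u , between) =
  flip-Shuf Su , flip-Shuf Sv , flip-≤bub v≤u , (λ e → v≢u (sym (flip-injective e))) , between′
  where
  between′ : ∀ w → Shuf n m w → flip u ≤bub w → w ≤bub flip v → w ≡ flip u ⊎ w ≡ flip v
  between′ w Sw u≤w w≤v
    with between (flip w) (flip-Shuf Sw) (subst (_≤bub flip w) (flip-involutive v) (flip-≤bub w≤v))
                                         (subst (flip w ≤bub_) (flip-involutive u) (flip-≤bub u≤w))
  ... | inj₁ e = inj₂ (trans (sym (flip-involutive w)) (cong flip e))
  ... | inj₂ e = inj₁ (trans (sym (flip-involutive w)) (cong flip e))

MeetIrreducible⇒JoinIrreducible-flip : ∀ {m n} {u : Word m n} → MeetIrreducible m n u → JoinIrreducible n m (flip u)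
MeetIrreducible⇒JoinIrreducible-flip (S , v , u⋖v , only) =
  flip-Shuf S , flip v , flip-⋖ u⋖v , λ w w⋖ →
    trans (sym (flip-involutive w)) (cong flip (only (flip w) (subst (_⋖ flip w) (flip-involutive _) (flip-⋖ w⋖))))

JoinIrreducible-flip⇒MeetIrreducible : ∀ {m n} {u : Word m n} → JoinIrreducible n m (flip u) → MeetIrreducible m n u
JoinIrreducible-flip⇒MeetIrreducible {m} {n} {u} (S , v , v⋖ , only) =
  subst (Shuf m n) (flip-involutive u) (flip-Shuf S) , flip v , subst (_⋖ flip v) (flip-involutive u) (flip-⋖ v⋖) ,
  λ w u⋖w → trans (sym (flip-involutive w)) (cong flip (only (flip w) (flip-⋖ u⋖w)))

meet-irreducibles-count : ∀ m n → HasExactly {m} {n} (m * n + m + n) (MeetIrreducible m n)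
meet-irreducibles-count m n with join-irreducibles-count {n} {m}
... | L , unique , length-L , ∈L⇔ =
  map flip L , Unique.map⁺ flip-injective unique , trans (List.length-map flip L) (trans length-L (rearrange n m)) ,
  λ u → mk⇔ (to u) (from u)
  where
  rearrange : ∀ a b → a * b + a + b ≡ b * a + b + a
  rearrange = solve-∀
  to : ∀ u → u ∈ map flip L → MeetIrreducible m n u
  to u u∈ with ∈-map⁻ flip u∈
  ... | t , t∈L , refl =
    JoinIrreducible-flip⇒MeetIrreducible (subst (JoinIrreducible n m) (sym (flip-involutive t)) (Equivalence.to (∈L⇔ t) t∈L))
  from : ∀ u → MeetIrreducible m n u → u ∈ map flip L
  from u mi = subst (_∈ map flip L) (flip-involutive u)
                    (∈-map⁺ flip (Equivalence.from (∈L⇔ (flip u)) (MeetIrreducible⇒JoinIrreducible-flip mi)))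

corollary4p9 : (m n : ℕ) →
    HasExactly {m} {n} (m * n + m + n) (JoinIrreducible m n)
    × HasExactly {m} {n} (m * n + m + n) (MeetIrreducible m n)
corollary4p9 m n = join-irreducibles-count , meet-irreducibles-count m n
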